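{- Let $n\ge2$ and let the array $A[1..n]$ contain a uniformly random permutation of $\{1,\dots,n\}$. Run one partitioning step (described in the context) on $A$ with $\mathit{left}=1$, $\mathit{right}=n$, and let $q=\max\{A[1],A[n]\}$ be the large pivot. Then at the moment the outer loop is exited (before the updates $\ell\gets\ell-1$, $g\gets g+1$), we have $g=q-1$ and \[ k=q+\delta=g+1+\delta\qquad\text{for some }\delta\in\{0,1\}. \] Moreover, $\delta=1$ if and only if initially $A[q]>q$.
   Context: Partitioning step of Yaroslavskiy's algorithm on $A[\mathit{left}..\mathit{right}]$: if $A[\mathit{left}]>A[\mathit{right}]$ set $p\gets A[\mathit{right}],q\gets A[\mathit{left}]$, else $p\gets A[\mathit{left}],q\gets A[\mathit{right}]$. Set $\ell\gets\mathit{left}+1$, $g\gets\mathit{right}-1$, $k\gets\ell$. While $k\le g$: (i) if $A[k]<p$: swap $A[k],A[\ell]$, $\ell\gets\ell+1$; (ii) else if $A[k]\ge q$: while ($A[g]>q$ and $k<g$) do $g\gets g-1$; then if $A[g]\ge p$ swap $A[k],A[g]$, else {swap $A[k],A[g]$; swap $A[k],A[\ell]$; $\ell\gets\ell+1$}; then $g\gets g-1$; (iii) $k\gets k+1$. After the loop: $\ell\gets\ell-1$, $g\gets g+1$; $A[\mathit{left}]\gets A[\ell]$, $A[\ell]\gets p$; $A[\mathit{right}]\gets A[g]$, $A[g]\gets q$. Since the array holds a permutation of $\{1,\dots,n\}$, values coincide with ranks. -}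

module Defs where

open import Data.Nat.Base using (ℕ; zero; suc; _+_; _∸_; _≤_; _<_; _≡ᵇ_; _<ᵇ_; _≤ᵇ_)
open import Data.Bool.Base using (Bool; true; false; if_then_else_; _∧_)
open import Data.Product using (_×_; _,_)
open import Relation.Binary.PropositionalEquality using (_≡_)

-- Arrays are modelled as functions ℕ → ℕ, indices 1..n are the meaningful ones.
Array : Set
Array = ℕ → ℕ

swap : Array → ℕ → ℕ → Array
swap A i j x = if x ≡ᵇ i then A j else (if x ≡ᵇ j then A i else A x)

IsPermutation : ℕ → Array → Set
IsPermutation n A =
  ((i : ℕ) → 1 ≤ i → i ≤ n → (1 ≤ A i × A i ≤ n)) ×
  ((i j : ℕ) → 1 ≤ i → i ≤ n → 1 ≤ j → j ≤ n → A i ≡ A j → i ≡ j)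

record State : Set where
  constructor st
  field
    arr : Array
    ell : ℕ
    gg  : ℕ
    kk  : ℕ
open State public

innerLoop : ℕ → Array → ℕ → ℕ → ℕ → ℕ
innerLoop zero      A q k g = g
innerLoop (suc fuel) A q k g =
  if (q <ᵇ A g) ∧ (k <ᵇ g) then innerLoop fuel A q k (g ∸ 1) else g

step : ℕ → ℕ → ℕ → State → State
step fuel p q (st A l g k) =
  if A k <ᵇ p
  then st (swap A k l) (suc l) g (suc k)
  else (if q ≤ᵇ A k
        then (let g' = innerLoop fuel A q k g in
              if p ≤ᵇ A g'
              then st (swap A k g') l (g' ∸ 1) (suc k)
              else st (swap (swap A k g') k l) (suc l) (g' ∸ 1) (suc k))
        else st A l g (suc k))

-- outer loop: while k ≤ g do step   (fuel-bounded; fuel n suffices since k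
-- strictly increases each iteration, starts at 2 and the loop stops once k > g ≤ n-1)
outerLoop : ℕ → ℕ → ℕ → ℕ → State → State
outerLoop zero       ifuel p q s = s
outerLoop (suc fuel) ifuel p q s =
  if kk s ≤ᵇ gg s then outerLoop fuel ifuel p q (step ifuel p q s) else s

smallPivot : ℕ → Array → ℕ
smallPivot n A = if A n <ᵇ A 1 then A n else A 1

largePivot : ℕ → Array → ℕ
largePivot n A = if A n <ᵇ A 1 then A 1 else A n

-- the state at the moment the outer loop is exited (before ℓ ← ℓ-1, g ← g+1),
-- for left = 1, right = n: ℓ = 2, g = n - 1, k = 2 initially
exitState : ℕ → Array → State
exitState n A = outerLoop n n (smallPivot n A) (largePivot n A) (st A 2 (n ∸ 1) 2)

-- While k scans rightwards and g leftwards, positions 2, …, k-1 (up to g) receive entries below q,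
-- positions g+1, …, n-1 entries above q, and k, …, g are untouched.  At the exit every interior
-- position up to g is below q and every later one above, so counting the values of the
-- permutation on either side of g forces g + 1 = q.  Since k ≤ g + 2 throughout, k = q + δ with
-- δ ≤ 1, and two further invariants tie δ = 1 to the original entry at position q.
module Submission where

open import Defs
open import Data.Bool.Base using (true; false; if_then_else_)
open import Data.Nat.Base
open import Data.Nat.Properties
open import Data.Fin.Base using (Fin; fromℕ<)
import Data.Fin.Properties as Fin
open import Data.Product using (_×_; _,_; proj₁; proj₂; Σ-syntax; ∃-syntax)
open import Data.Sum using (_⊎_; inj₁; inj₂)
import Data.Sum as Sum
import Data.Product as Product
open import Function.Base using (id)
open import Function.Bundles using (_⇔_; mk⇔)
open import Relation.Nullary using (¬_; yes; no; contradiction; proof)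
open import Relation.Nullary.Reflects using (Reflects; ofʸ; ofⁿ)
open import Relation.Binary.PropositionalEquality

≡ᵇ-reflects-≡ : ∀ m n → Reflects (m ≡ n) (m ≡ᵇ n)
≡ᵇ-reflects-≡ m n = proof (m ≟ n)

swap-atˡ : ∀ A i j → swap A i j i ≡ A j
swap-atˡ A i j with i ≡ᵇ i | ≡ᵇ-reflects-≡ i i
... | true  | _       = refl
... | false | ofⁿ i≢i = contradiction refl i≢i

swap-atʳ : ∀ A i j → swap A i j j ≡ A i
swap-atʳ A i j with j ≡ᵇ i | ≡ᵇ-reflects-≡ j i
... | true  | ofʸ refl = refl
... | false | _ with j ≡ᵇ j | ≡ᵇ-reflects-≡ j j
...   | true  | _       = refl
...   | false | ofⁿ j≢j = contradiction refl j≢j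

swap-elsewhere : ∀ A {i j x} → x ≢ i → x ≢ j → swap A i j x ≡ A x
swap-elsewhere A {i} {j} {x} x≢i x≢j
  with x ≡ᵇ i | ≡ᵇ-reflects-≡ x i | x ≡ᵇ j | ≡ᵇ-reflects-≡ x j
... | true  | ofʸ x≡i | _     | _        = contradiction x≡i x≢i
... | false | _       | true  | ofʸ x≡j  = contradiction x≡j x≢j
... | false | _       | false | _        = refl

swap-preserves : ∀ {P Q : ℕ → Set} A {i j} → (∀ {x} → P x → Q (A x)) →
                 P i → P j → ∀ {x} → P x → Q (swap A i j x)
swap-preserves A {i} {j} PQ Pi Pj {x} Px with x ≡ᵇ i
... | true  = PQ Pj
... | false with x ≡ᵇ j
...   | true  = PQ Pi
...   | false = PQ Px

transposition : ℕ → ℕ → ℕ → ℕ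
transposition = swap id

swap≗∘transposition : ∀ A i j x → swap A i j x ≡ A (transposition i j x)
swap≗∘transposition A i j x with x ≡ᵇ i
... | true  = refl
... | false with x ≡ᵇ j
...   | true  = refl
...   | false = refl

transposition-involutive : ∀ i j x → transposition i j (transposition i j x) ≡ x
transposition-involutive i j x with x ≟ i | x ≟ j
... | yes refl | _ = trans (cong (transposition x j) (swap-atˡ id x j)) (swap-atʳ id x j)
... | no _ | yes refl = trans (cong (transposition i x) (swap-atʳ id i x)) (swap-atˡ id i x)
... | no x≢i | no x≢j =
  trans (cong (transposition i j) (swap-elsewhere id x≢i x≢j)) (swap-elsewhere id x≢i x≢j)

InRange : ℕ → ℕ → Set
InRange n x = 1 ≤ x × x ≤ n

swap-preserves-IsPermutation : ∀ {n A i j} → 1 ≤ i → i ≤ n → 1 ≤ j → j ≤ n →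
                               IsPermutation n A → IsPermutation n (swap A i j)
swap-preserves-IsPermutation {n} {A} {i} {j} 1≤i i≤n 1≤j j≤n (range , injective) =
  range′ , injective′
  where
  τ : ℕ → ℕ
  τ = transposition i j

  τ-range : ∀ {x} → InRange n x → InRange n (τ x)
  τ-range = swap-preserves {InRange n} {InRange n} id id (1≤i , i≤n) (1≤j , j≤n)

  range′ : ∀ x → 1 ≤ x → x ≤ n → 1 ≤ swap A i j x × swap A i j x ≤ n
  range′ x 1≤x x≤n =
    swap-preserves {InRange n} {InRange n} A (λ (1≤y , y≤n) → range _ 1≤y y≤n)
                   (1≤i , i≤n) (1≤j , j≤n) (1≤x , x≤n)

  injective′ : ∀ x y → 1 ≤ x → x ≤ n → 1 ≤ y → y ≤ n → swap A i j x ≡ swap A i j y → x ≡ y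
  injective′ x y 1≤x x≤n 1≤y y≤n eq = begin
    x           ≡⟨ transposition-involutive i j x ⟨
    τ (τ x)     ≡⟨ cong τ (injective _ _ (proj₁ τx) (proj₂ τx) (proj₁ τy) (proj₂ τy) Aτx≡Aτy) ⟩
    τ (τ y)     ≡⟨ transposition-involutive i j y ⟩
    y           ∎
    where
    open ≡-Reasoning
    τx : InRange n (τ x)
    τx = τ-range (1≤x , x≤n)
    τy : InRange n (τ y)
    τy = τ-range (1≤y , y≤n)
    Aτx≡Aτy : A (τ x) ≡ A (τ y)
    Aτx≡Aτy = trans (sym (swap≗∘transposition A i j x)) (trans eq (swap≗∘transposition A i j y))

injective-below⇒≤ : ∀ {m c} (f : ℕ → ℕ) → (∀ {i} → i < m → f i < c) →
                    (∀ {i j} → i < m → j < m → f i ≡ f j → i ≡ j) → m ≤ c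
injective-below⇒≤ f bounded injective = Fin.injective⇒≤ {f = f′} f′-injective
  where
  f′ : Fin _ → Fin _
  f′ i = fromℕ< (bounded (Fin.toℕ<n i))

  f′-injective : ∀ {i j} → f′ i ≡ f′ j → i ≡ j
  f′-injective {i} {j} eq = Fin.toℕ-injective
    (injective (Fin.toℕ<n i) (Fin.toℕ<n j) (Fin.fromℕ<-injective _ _ _ _ eq))

-- Shifting by lo turns the block into an injection of {0, …, m-1} into {0, …, hi-lo-1}.
block-within⇒≤ : ∀ {n A a m lo hi} → IsPermutation n A → a + m ≤ n →
                 (∀ x → a < x → x ≤ a + m → lo ≤ A x × A x < hi) → m ≤ hi ∸ lo
block-within⇒≤ {n} {A} {a} {m} {lo} {hi} (_ , injective) a+m≤n within =
  injective-below⇒≤ (λ i → A (suc (a + i)) ∸ lo) bounded distinct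
  where
  in-block : ∀ {i} → i < m → a < suc (a + i) × suc (a + i) ≤ a + m
  in-block {i} i<m = s≤s (m≤m+n a i) , subst (_≤ a + m) (+-suc a i) (+-monoʳ-≤ a i<m)

  in-range : ∀ {i} → i < m → 1 ≤ suc (a + i) × suc (a + i) ≤ n
  in-range i<m = s≤s z≤n , ≤-trans (proj₂ (in-block i<m)) a+m≤n

  value : ∀ {i} → i < m → lo ≤ A (suc (a + i)) × A (suc (a + i)) < hi
  value i<m = within _ (proj₁ (in-block i<m)) (proj₂ (in-block i<m))

  bounded : ∀ {i} → i < m → A (suc (a + i)) ∸ lo < hi ∸ lo
  bounded i<m = ∸-monoˡ-< (proj₂ (value i<m)) (proj₁ (value i<m))

  distinct : ∀ {i j} → i < m → j < m → A (suc (a + i)) ∸ lo ≡ A (suc (a + j)) ∸ lo → i ≡ j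
  distinct {i} {j} i<m j<m eq = +-cancelˡ-≡ a i j (suc-injective
    (injective _ _ (proj₁ (in-range i<m)) (proj₂ (in-range i<m))
                   (proj₁ (in-range j<m)) (proj₂ (in-range j<m))
                   (∸-cancelʳ-≡ (proj₁ (value i<m)) (proj₁ (value j<m)) eq)))

suc[n∸1]≡n : ∀ {n} → 1 ≤ n → suc (n ∸ 1) ≡ n
suc[n∸1]≡n (s≤s _) = refl

threshold-position : ∀ {n A g q} → IsPermutation n A → g ≤ n → 1 ≤ q → q ≤ suc n →
                     (∀ x → 1 ≤ x → x ≤ g → A x < q) → (∀ x → g < x → x ≤ n → q ≤ A x) →
                     suc g ≡ q
threshold-position {n} {g = g} {q} perm g≤n 1≤q q≤1+n below above =
  ≤-antisym g<q (≮⇒≥ (λ 1+g<q → <⇒≱ (∸-monoʳ-< 1+g<q q≤1+n) n∸g≤1+n∸q))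
  where
  g≤q∸1 : g ≤ q ∸ 1
  g≤q∸1 = block-within⇒≤ {a = 0} perm g≤n
    (λ x 0<x x≤g → proj₁ (proj₁ perm x 0<x (≤-trans x≤g g≤n)) , below x 0<x x≤g)

  g<q : g < q
  g<q = ≤-trans (s≤s g≤q∸1) (≤-reflexive (suc[n∸1]≡n 1≤q))

  n∸g≤1+n∸q : n ∸ g ≤ suc n ∸ q
  n∸g≤1+n∸q = block-within⇒≤ {a = g} perm (≤-reflexive (m+[n∸m]≡n g≤n))
    (λ x g<x x≤g+[n∸g] → let x≤n = subst (x ≤_) (m+[n∸m]≡n g≤n) x≤g+[n∸g] in
      above x g<x x≤n , s≤s (proj₂ (proj₁ perm x (≤-trans (s≤s z≤n) g<x) x≤n)))

Ends : ℕ → Array → ℕ → ℕ → Set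
Ends n A u v = (A 1 ≡ u × A n ≡ v) ⊎ (A 1 ≡ v × A n ≡ u)

pivots-at-ends : ∀ n A → Ends n A (smallPivot n A) (largePivot n A)
pivots-at-ends n A with A n <ᵇ A 1
... | true  = inj₂ (refl , refl)
... | false = inj₁ (refl , refl)

smallPivot<largePivot : ∀ {n A} → 2 ≤ n → IsPermutation n A → smallPivot n A < largePivot n A
smallPivot<largePivot {n} {A} n≥2 (_ , injective) with A n <ᵇ A 1 | <ᵇ-reflects-< (A n) (A 1)
... | true  | ofʸ An<A1 = An<A1
... | false | ofⁿ An≮A1 =
  ≤∧≢⇒< (≮⇒≥ An≮A1) (λ A1≡An → <⇒≢ n≥2 (injective 1 n ≤-refl 1≤n 1≤n ≤-refl A1≡An))
  where
  1≤n : 1 ≤ n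
  1≤n = ≤-trans (s≤s z≤n) n≥2

swap-preserves-Ends : ∀ {n A u v i j} → 1 < i → i < n → 1 < j → j < n →
                      Ends n A u v → Ends n (swap A i j) u v
swap-preserves-Ends {n} {A} {i = i} {j} 1<i i<n 1<j j<n =
  Sum.map (Product.map (trans first) (trans last)) (Product.map (trans first) (trans last))
  where
  first : swap A i j 1 ≡ A 1
  first = swap-elsewhere A (<⇒≢ 1<i) (<⇒≢ 1<j)
  last : swap A i j n ≡ A n
  last = swap-elsewhere A (>⇒≢ i<n) (>⇒≢ j<n)

interior-≢-end : ∀ {n A u v x} → IsPermutation n A → Ends n A u v → 1 < x → x < n → A x ≢ v
interior-≢-end {n} {A} {v = v} {x} (_ , injective) ends 1<x x<n Ax≡v =
  Sum.[ (λ (_ , An≡v) → <⇒≢ x<n (position-of-v n (1≤n , ≤-refl) An≡v))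
      , (λ (A1≡v , _) → >⇒≢ 1<x (position-of-v 1 (≤-refl , 1≤n) A1≡v))
      ] ends
  where
  1≤n : 1 ≤ n
  1≤n = ≤-trans (<⇒≤ 1<x) (<⇒≤ x<n)

  position-of-v : ∀ y → InRange n y → A y ≡ v → x ≡ y
  position-of-v y (1≤y , y≤n) Ay≡v =
    injective x y (<⇒≤ 1<x) (<⇒≤ x<n) 1≤y y≤n (trans Ax≡v (sym Ay≡v))

ends-sorted : ∀ {n A u v} → 1 ≤ n → IsPermutation n A → Ends n A u v →
              Σ[ B ∈ Array ] IsPermutation n B × B 1 ≡ u × B n ≡ v ×
                             (∀ {x} → 1 < x → x < n → B x ≡ A x)
ends-sorted {A = A} _ perm (inj₁ (A1≡u , An≡v)) = A , perm , A1≡u , An≡v , λ _ _ → refl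
ends-sorted {n} {A} 1≤n perm (inj₂ (A1≡v , An≡u)) =
  swap A 1 n ,
  swap-preserves-IsPermutation ≤-refl 1≤n 1≤n ≤-refl perm ,
  trans (swap-atˡ A 1 n) An≡u ,
  trans (swap-atʳ A 1 n) A1≡v ,
  λ 1<x x<n → swap-elsewhere A (>⇒≢ 1<x) (<⇒≢ x<n)

record InnerLoopExit (A : Array) (q k g g′ : ℕ) : Set where
  field
    k≤g′    : k ≤ g′
    g′≤g    : g′ ≤ g
    skipped : ∀ {x} → g′ < x → x ≤ g → q < A x
    stopped : A g′ ≤ q ⊎ g′ ≤ k

exit-immediately : ∀ {A q k g} → k ≤ g → A g ≤ q ⊎ g ≤ k → InnerLoopExit A q k g g
exit-immediately k≤g stop = record
  { k≤g′    = k≤g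
  ; g′≤g    = ≤-refl
  ; skipped = λ g<x x≤g → contradiction x≤g (<⇒≱ g<x)
  ; stopped = stop
  }

exit-after-skipping : ∀ {A q k h g′} → q < A (suc h) → InnerLoopExit A q k h g′ →
                      InnerLoopExit A q k (suc h) g′
exit-after-skipping {A} {q} {h = h} {g′} q<A exit = record
  { k≤g′    = k≤g′
  ; g′≤g    = m≤n⇒m≤1+n g′≤g
  ; skipped = skipped′
  ; stopped = stopped
  }
  where
  open InnerLoopExit exit

  skipped′ : ∀ {x} → g′ < x → x ≤ suc h → q < A x
  skipped′ g′<x x≤1+h with m≤n⇒m<n∨m≡n x≤1+h
  ... | inj₁ x<1+h = skipped g′<x (s≤s⁻¹ x<1+h)
  ... | inj₂ refl  = q<A

innerLoop-exit : ∀ fuel A q k g → k ≤ g → g ≤ fuel → InnerLoopExit A q k g (innerLoop fuel A q k g)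
innerLoop-exit zero A q k g k≤g g≤0 = exit-immediately k≤g (inj₂ (≤-trans g≤0 z≤n))
innerLoop-exit (suc fuel) A q k g k≤g g≤1+fuel
  with q <ᵇ A g | <ᵇ-reflects-< q (A g) | k <ᵇ g | <ᵇ-reflects-< k g
... | false | ofⁿ q≮Ag | _     | _       = exit-immediately k≤g (inj₁ (≮⇒≥ q≮Ag))
... | true  | _        | false | ofⁿ k≮g = exit-immediately k≤g (inj₂ (≮⇒≥ k≮g))
... | true  | ofʸ q<Ag | true  | ofʸ k<g = skip k<g q<Ag g≤1+fuel
  where
  skip : ∀ {g} → k < g → q < A g → g ≤ suc fuel →
         InnerLoopExit A q k g (innerLoop fuel A q k (g ∸ 1))
  skip {suc h} k<1+h q<A (s≤s h≤fuel) =
    exit-after-skipping q<A (innerLoop-exit fuel A q k h (s≤s⁻¹ k<1+h) h≤fuel)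

Scanned : ℕ → ℕ → ℕ → Set
Scanned k g x = 1 < x × x < k × x ≤ g

module Partitioning {n : ℕ} (n≥2 : 2 ≤ n) {A₀ : Array} (A₀-perm : IsPermutation n A₀) where

  p q : ℕ
  p = smallPivot n A₀
  q = largePivot n A₀

  1≤n : 1 ≤ n
  1≤n = ≤-trans (s≤s z≤n) n≥2

  p<q : p < q
  p<q = smallPivot<largePivot n≥2 A₀-perm

  1≤q : 1 ≤ q
  1≤q = ≤-trans (s≤s z≤n) p<q

  q≤n : q ≤ n
  q≤n with ends-sorted 1≤n A₀-perm (pivots-at-ends n A₀)
  ... | B , (range , _) , _ , Bn≡q , _ = subst (_≤ n) Bn≡q (proj₂ (range n 1≤n ≤-refl))

  -- The last two fields decide δ.  k can reach g + 2 only when case (ii) exchanges A[k]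
  -- with itself, and that entry is an untouched original one exceeding q.  If A₀[q] > q,
  -- the inner loop never stops at position q while k < q, so g cannot drop to q - 1 first.
  record Invariant (s : State) : Set where
    field
      perm      : IsPermutation n (arr s)
      ends      : Ends n (arr s) p q
      1<ℓ       : 1 < ell s
      ℓ≤k       : ell s ≤ kk s
      k≤2+g     : kk s ≤ 2 + gg s
      0<g       : 0 < gg s
      g<n       : gg s < n
      unscanned : ∀ {x} → kk s ≤ x → x ≤ gg s → arr s x ≡ A₀ x
      below     : ∀ {x} → Scanned (kk s) (gg s) x → arr s x < q
      above     : ∀ {x} → gg s < x → x < n → q < arr s x
      crossed   : kk s ≡ 2 + gg s → q < A₀ (suc (gg s))
      overtaken : q < A₀ q → gg s < q → q < kk s ⊎ 2 + gg s ≤ q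

  Advances : State → State → Set
  Advances s s′ = Invariant s′ × kk s′ ≡ suc (kk s) × gg s′ ≤ gg s

  -- The state just before k is incremented, once A[k] is known to be smaller than q.
  record ReadyToAdvance (A : Array) (l g k : ℕ) : Set where
    field
      perm      : IsPermutation n A
      ends      : Ends n A p q
      1<ℓ       : 1 < l
      ℓ≤k       : l ≤ k
      k≤1+g     : k ≤ suc g
      0<g       : 0 < g
      g<n       : g < n
      unscanned : ∀ {x} → k < x → x ≤ g → A x ≡ A₀ x
      below     : ∀ {x} → Scanned k g x → A x < q
      above     : ∀ {x} → g < x → x < n → q < A x
      current   : k ≤ g → A k < q

  extend-below : ∀ {A : Array} {g k} → (∀ {x} → Scanned k g x → A x < q) → (k ≤ g → A k < q) →
                 ∀ {x} → Scanned (suc k) g x → A x < q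
  extend-below below current (1<x , x<1+k , x≤g) with m≤n⇒m<n∨m≡n (s≤s⁻¹ x<1+k)
  ... | inj₁ x<k  = below (1<x , x<k , x≤g)
  ... | inj₂ refl = current x≤g

  module _ {A l g k} (R : ReadyToAdvance A l g k)
           (crossed : suc k ≡ 2 + g → q < A₀ (suc g))
           (overtaken : q < A₀ q → g < q → q < suc k ⊎ 2 + g ≤ q) where
    open ReadyToAdvance R

    advance : Invariant (st A l g (suc k))
    advance = record
      { perm      = perm
      ; ends      = ends
      ; 1<ℓ       = 1<ℓ
      ; ℓ≤k       = m≤n⇒m≤1+n ℓ≤k
      ; k≤2+g     = s≤s k≤1+g
      ; 0<g       = 0<g
      ; g<n       = g<n
      ; unscanned = unscanned
      ; below     = extend-below below current
      ; above     = above
      ; crossed   = crossed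
      ; overtaken = overtaken
      }

    advance-with-swap : k ≤ g → Invariant (st (swap A k l) (suc l) g (suc k))
    advance-with-swap k≤g = record
      { perm      = swap-preserves-IsPermutation (<⇒≤ 1<k) (<⇒≤ k<n) (<⇒≤ 1<ℓ) (<⇒≤ ℓ<n) perm
      ; ends      = swap-preserves-Ends 1<k k<n 1<ℓ ℓ<n ends
      ; 1<ℓ       = m≤n⇒m≤1+n 1<ℓ
      ; ℓ≤k       = s≤s ℓ≤k
      ; k≤2+g     = s≤s k≤1+g
      ; 0<g       = 0<g
      ; g<n       = g<n
      ; unscanned = λ k<x x≤g → trans (untouched k<x) (unscanned k<x x≤g)
      ; below     = swap-preserves {Scanned (suc k) g} {_< q} A (extend-below below current)
                                   (1<k , ≤-refl , k≤g) (1<ℓ , s≤s ℓ≤k , ℓ≤g)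
      ; above     = λ g<x x<n → subst (q <_) (sym (untouched (≤-<-trans k≤g g<x))) (above g<x x<n)
      ; crossed   = crossed
      ; overtaken = overtaken
      }
      where
      1<k : 1 < k
      1<k = ≤-trans 1<ℓ ℓ≤k
      k<n : k < n
      k<n = ≤-<-trans k≤g g<n
      ℓ<n : l < n
      ℓ<n = ≤-<-trans ℓ≤k k<n
      ℓ≤g : l ≤ g
      ℓ≤g = ≤-trans ℓ≤k k≤g

      untouched : ∀ {x} → k < x → swap A k l x ≡ A x
      untouched k<x = swap-elsewhere A (>⇒≢ k<x) (>⇒≢ (≤-<-trans ℓ≤k k<x))

  module Step {A l g k} (I : Invariant (st A l g k)) (k≤g : k ≤ g) where
    open Invariant I

    1<k : 1 < k
    1<k = ≤-trans 1<ℓ ℓ≤k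

    k<n : k < n
    k<n = ≤-<-trans k≤g g<n

    ready : A k < q → ReadyToAdvance A l g k
    ready Ak<q = record
      { perm      = perm
      ; ends      = ends
      ; 1<ℓ       = 1<ℓ
      ; ℓ≤k       = ℓ≤k
      ; k≤1+g     = m≤n⇒m≤1+n k≤g
      ; 0<g       = 0<g
      ; g<n       = g<n
      ; unscanned = λ k<x → unscanned (<⇒≤ k<x)
      ; below     = below
      ; above     = above
      ; current   = λ _ → Ak<q
      }

    crossed-unchanged : suc k ≡ 2 + g → q < A₀ (suc g)
    crossed-unchanged 1+k≡2+g = contradiction (subst (_≤ g) (suc-injective 1+k≡2+g) k≤g) 1+n≰n

    overtaken-unchanged : q < A₀ q → g < q → q < suc k ⊎ 2 + g ≤ q
    overtaken-unchanged A₀[q]>q g<q = Sum.map₁ m≤n⇒m≤1+n (overtaken A₀[q]>q g<q)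

    small : A k < p → Advances (st A l g k) (st (swap A k l) (suc l) g (suc k))
    small Ak<p =
      advance-with-swap (ready (<-trans Ak<p p<q)) crossed-unchanged overtaken-unchanged k≤g ,
      refl , ≤-refl

    medium : A k < q → Advances (st A l g k) (st A l g (suc k))
    medium Ak<q = advance (ready Ak<q) crossed-unchanged overtaken-unchanged , refl , ≤-refl

    module Exchange (q≤Ak : q ≤ A k) {h} (exit : InnerLoopExit A q k g (suc h)) where
      open InnerLoopExit exit

      q<Ak : q < A k
      q<Ak = ≤∧≢⇒< q≤Ak (≢-sym (interior-≢-end perm ends 1<k k<n))

      1<g′ : 1 < suc h
      1<g′ = ≤-trans 1<k k≤g′

      g′<n : suc h < n
      g′<n = ≤-<-trans g′≤g g<n

      h≤g : h ≤ g
      h≤g = ≤-trans (n≤1+n h) g′≤g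

      A[g′]<q : k ≤ h → A (suc h) < q
      A[g′]<q k≤h = Sum.[ (λ A[g′]≤q → ≤∧≢⇒< A[g′]≤q (interior-≢-end perm ends 1<g′ g′<n))
                        , (λ g′≤k → contradiction (≤-trans g′≤k k≤h) 1+n≰n)
                        ] stopped

      above-g′ : ∀ {x} → suc h < x → x < n → q < A x
      above-g′ {x} g′<x x<n with x ≤? g
      ... | yes x≤g = skipped g′<x x≤g
      ... | no  x≰g = above (≰⇒> x≰g) x<n

      exchanged-above : ∀ {x} → h < x → x < n → q < swap A k (suc h) x
      exchanged-above h<x x<n with m≤n⇒m<n∨m≡n h<x
      ... | inj₂ refl = subst (q <_) (sym (swap-atʳ A k (suc h))) q<Ak
      ... | inj₁ g′<x =
        subst (q <_) (sym (swap-elsewhere A (>⇒≢ (≤-<-trans k≤g′ g′<x)) (>⇒≢ g′<x))) (above-g′ g′<x x<n)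

      exchanged : ReadyToAdvance (swap A k (suc h)) l h k
      exchanged = record
        { perm      = swap-preserves-IsPermutation (<⇒≤ 1<k) (<⇒≤ k<n) (<⇒≤ 1<g′) (<⇒≤ g′<n) perm
        ; ends      = swap-preserves-Ends 1<k k<n 1<g′ g′<n ends
        ; 1<ℓ       = 1<ℓ
        ; ℓ≤k       = ℓ≤k
        ; k≤1+g     = k≤g′
        ; 0<g       = s≤s⁻¹ 1<g′
        ; g<n       = <-trans (n<1+n h) g′<n
        ; unscanned = λ k<x x≤h → trans (swap-elsewhere A (>⇒≢ k<x) (<⇒≢ (s≤s x≤h)))
                                        (unscanned (<⇒≤ k<x) (≤-trans x≤h h≤g))
        ; below     = λ (1<x , x<k , x≤h) →
                        subst (_< q) (sym (swap-elsewhere A (<⇒≢ x<k) (<⇒≢ (s≤s x≤h))))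
                              (below (1<x , x<k , ≤-trans x≤h h≤g))
        ; above     = exchanged-above
        ; current   = λ k≤h → subst (_< q) (sym (swap-atˡ A k (suc h))) (A[g′]<q k≤h)
        }

      -- Position q cannot be where the inner loop stopped: it still holds A₀[q] > q.
      overtaken-exchanged : q < A₀ q → h < q → q < suc k ⊎ 2 + h ≤ q
      overtaken-exchanged A₀[q]>q h<q with m≤n⇒m<n∨m≡n h<q
      ... | inj₁ g′<q = inj₂ g′<q
      ... | inj₂ g′≡q = Sum.[ (λ A[g′]≤q → contradiction A[g′]≤q (<⇒≱ q<A[g′]))
                            , (λ g′≤k → inj₁ (s≤s (subst (_≤ k) g′≡q g′≤k)))
                            ] stopped
        where
        q<A[g′] : q < A (suc h)
        q<A[g′] = subst (q <_) (trans (cong A₀ (sym g′≡q)) (sym (unscanned k≤g′ g′≤g))) A₀[q]>q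

      crossed-exchanged : suc k ≡ 2 + h → q < A₀ (suc h)
      crossed-exchanged 1+k≡2+h =
        subst (λ y → q < A₀ y) (suc-injective 1+k≡2+h) (subst (q <_) (unscanned ≤-refl k≤g) q<Ak)

      k≤h : A (suc h) < p → k ≤ h
      k≤h A[g′]<p = s≤s⁻¹ (≤∧≢⇒< k≤g′ λ k≡g′ →
        <-irrefl (cong A (sym k≡g′)) (<-trans A[g′]<p (<-trans p<q q<Ak)))

      advances : Advances (st A l g k)
        (if p ≤ᵇ A (suc h) then st (swap A k (suc h)) l h (suc k)
         else st (swap (swap A k (suc h)) k l) (suc l) h (suc k))
      advances with p ≤ᵇ A (suc h) | ≤ᵇ-reflects-≤ p (A (suc h))
      ... | true  | _ = advance exchanged crossed-exchanged overtaken-exchanged , refl , h≤g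
      ... | false | ofⁿ p≰A[g′] =
        advance-with-swap exchanged crossed-impossible overtaken-exchanged k≤h′ , refl , h≤g
        where
        k≤h′ : k ≤ h
        k≤h′ = k≤h (≰⇒> p≰A[g′])

        crossed-impossible : suc k ≡ 2 + h → q < A₀ (suc h)
        crossed-impossible 1+k≡2+h = contradiction (subst (_≤ h) (suc-injective 1+k≡2+h) k≤h′) 1+n≰n

    large : q ≤ A k → ∀ {g′} → InnerLoopExit A q k g g′ →
            Advances (st A l g k)
              (if p ≤ᵇ A g′ then st (swap A k g′) l (g′ ∸ 1) (suc k)
               else st (swap (swap A k g′) k l) (suc l) (g′ ∸ 1) (suc k))
    large q≤Ak {zero}  exit = contradiction (≤-trans 1<k (InnerLoopExit.k≤g′ exit)) λ ()
    large q≤Ak {suc h} exit = Exchange.advances q≤Ak exit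

    advances : Advances (st A l g k) (step n p q (st A l g k))
    advances with A k <ᵇ p | <ᵇ-reflects-< (A k) p
    ... | true  | ofʸ Ak<p = small Ak<p
    ... | false | _ with q ≤ᵇ A k | ≤ᵇ-reflects-≤ q (A k)
    ...   | false | ofⁿ q≰Ak = medium (≰⇒> q≰Ak)
    ...   | true  | ofʸ q≤Ak = large q≤Ak (innerLoop-exit n A q k g k≤g (<⇒≤ g<n))

  Exited : State → Set
  Exited s = Invariant s × gg s < kk s

  outerLoop-exit : ∀ fuel s → Invariant s → gg s < fuel + kk s → Exited (outerLoop fuel n p q s)
  outerLoop-exit zero       s I g<k = I , g<k
  outerLoop-exit (suc fuel) s I g<1+fuel+k with kk s ≤ᵇ gg s | ≤ᵇ-reflects-≤ (kk s) (gg s)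
  ... | false | ofⁿ k≰g = I , ≰⇒> k≰g
  ... | true  | ofʸ k≤g with Step.advances I k≤g
  ...   | I′ , k′≡1+k , g′≤g = outerLoop-exit fuel _ I′ (≤-<-trans g′≤g g<fuel+k′)
    where
    g<fuel+k′ : gg s < fuel + kk (step n p q s)
    g<fuel+k′ = subst (gg s <_) (trans (sym (+-suc fuel (kk s))) (cong (fuel +_) (sym k′≡1+k)))
                      g<1+fuel+k

  initial : Invariant (st A₀ 2 (n ∸ 1) 2)
  initial = record
    { perm      = A₀-perm
    ; ends      = pivots-at-ends n A₀
    ; 1<ℓ       = ≤-refl
    ; ℓ≤k       = ≤-refl
    ; k≤2+g     = s≤s (s≤s z≤n)
    ; 0<g       = 0<g
    ; g<n       = subst (n ∸ 1 <_) 1+g≡n ≤-refl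
    ; unscanned = λ _ _ → refl
    ; below     = λ (1<x , x<2 , _) → contradiction 1<x (<⇒≱ x<2)
    ; above     = λ g<x x<n → contradiction (subst (_≤ _) 1+g≡n g<x) (<⇒≱ x<n)
    ; crossed   = λ 2≡2+g → contradiction (suc-injective (suc-injective 2≡2+g)) (<⇒≢ 0<g)
    ; overtaken = λ A₀[q]>q g<q → contradiction (A₀[q]≤q (≤-antisym q≤n (subst (_≤ q) 1+g≡n g<q)))
                                                (<⇒≱ A₀[q]>q)
    }
    where
    0<g : 0 < n ∸ 1
    0<g = ∸-monoˡ-≤ 1 n≥2

    1+g≡n : suc (n ∸ 1) ≡ n
    1+g≡n = suc[n∸1]≡n 1≤n

    A₀[q]≤q : q ≡ n → A₀ q ≤ q
    A₀[q]≤q q≡n = subst (A₀ q ≤_) (sym q≡n) (proj₂ (proj₁ A₀-perm q 1≤q q≤n))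

  -- Sorting the two pivots into the ends leaves exactly the values below q in positions 1, …, g.
  exit-gap : ∀ {s} → Exited s → suc (gg s) ≡ q
  exit-gap {st A _ g _} (I , g<k) = from-sorted (ends-sorted 1≤n perm ends)
    where
    open Invariant I

    from-sorted : Σ[ B ∈ Array ] IsPermutation n B × B 1 ≡ p × B n ≡ q ×
                                 (∀ {x} → 1 < x → x < n → B x ≡ A x) → suc g ≡ q
    from-sorted (B , B-perm , B[1]≡p , B[n]≡q , B≗A) =
      threshold-position B-perm (<⇒≤ g<n) 1≤q (m≤n⇒m≤1+n q≤n) lower upper
      where
        lower : ∀ x → 1 ≤ x → x ≤ g → B x < q
        lower x 1≤x x≤g with m≤n⇒m<n∨m≡n 1≤x
        ... | inj₂ refl = subst (_< q) (sym B[1]≡p) p<q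
        ... | inj₁ 1<x  = subst (_< q) (sym (B≗A 1<x (≤-<-trans x≤g g<n)))
                                (below (1<x , ≤-<-trans x≤g g<k , x≤g))

        upper : ∀ x → g < x → x ≤ n → q ≤ B x
        upper x g<x x≤n with m≤n⇒m<n∨m≡n x≤n
        ... | inj₂ refl = ≤-reflexive (sym B[n]≡q)
        ... | inj₁ x<n  = <⇒≤ (subst (q <_) (sym (B≗A (≤-<-trans 0<g g<x) x<n)) (above g<x x<n))

  exit-overshoot : ∀ {s} → Exited s → (kk s ≡ q × q ≮ A₀ q) ⊎ (kk s ≡ suc q × q < A₀ q)
  exit-overshoot {st _ _ g k} (I , g<k) = classify (m≤n⇒m<n∨m≡n q≤k)
    where
    open Invariant I

    1+g≡q : suc g ≡ q
    1+g≡q = exit-gap (I , g<k)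

    q≤k : q ≤ k
    q≤k = subst (_≤ k) 1+g≡q g<k

    k≤1+q : k ≤ suc q
    k≤1+q = subst (k ≤_) (cong suc 1+g≡q) k≤2+g

    classify : q < k ⊎ q ≡ k → (k ≡ q × q ≮ A₀ q) ⊎ (k ≡ suc q × q < A₀ q)
    classify (inj₁ q<k) =
      inj₂ (k≡1+q , subst (λ y → q < A₀ y) 1+g≡q (crossed (trans k≡1+q (cong suc (sym 1+g≡q)))))
      where
      k≡1+q : k ≡ suc q
      k≡1+q = ≤-antisym k≤1+q q<k
    classify (inj₂ q≡k) = inj₁ (sym q≡k , λ A₀[q]>q →
      Sum.[ (λ q<k → <⇒≢ q<k q≡k)
          , (λ 2+g≤q → 1+n≰n (subst (suc (suc g) ≤_) (sym 1+g≡q) 2+g≤q))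
          ] (overtaken A₀[q]>q (subst (g <_) 1+g≡q ≤-refl)))

overshoot : ∀ {k q} {P : Set} → (k ≡ q × ¬ P) ⊎ (k ≡ suc q × P) →
            ∃[ δ ] (δ ≤ 1 × k ≡ q + δ × (δ ≡ 1 ⇔ P))
overshoot (inj₁ (k≡q , ¬P)) =
  0 , z≤n , trans k≡q (sym (+-identityʳ _)) , mk⇔ (λ ()) (λ P → contradiction P ¬P)
overshoot (inj₂ (k≡1+q , P)) =
  1 , ≤-refl , trans k≡1+q (+-comm 1 _) , mk⇔ (λ _ → P) (λ _ → refl)

lemma3p3 : (n : ℕ) → 2 ≤ n → (A : Array) → IsPermutation n A →
    gg (exitState n A) < kk (exitState n A) ×
    gg (exitState n A) + 1 ≡ largePivot n A ×
    ∃[ δ ] (δ ≤ 1 ×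
            kk (exitState n A) ≡ largePivot n A + δ ×
            kk (exitState n A) ≡ gg (exitState n A) + 1 + δ ×
            (δ ≡ 1 ⇔ largePivot n A < A (largePivot n A)))
lemma3p3 n n≥2 A perm =
  let (δ , δ≤1 , k≡q+δ , δ≡1⇔A[q]>q) = overshoot (exit-overshoot exited) in
  proj₂ exited , g+1≡q , δ , δ≤1 , k≡q+δ , trans k≡q+δ (cong (_+ δ) (sym g+1≡q)) , δ≡1⇔A[q]>q
  where
  open Partitioning n≥2 perm

  exited : Exited (exitState n A)
  exited = outerLoop-exit n _ initial (<-≤-trans (Invariant.g<n initial) (m≤m+n n 2))

  g+1≡q : gg (exitState n A) + 1 ≡ largePivot n A
  g+1≡q = trans (+-comm _ 1) (exit-gap exited)
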